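{- Let $p$ be a prime and let $d,n,m$ be positive integers with $d \mid (p^m-1)$ and $p \mid n$. Let $\delta \in \mathbb{F}_{p^{mn}}$ with $\mathrm{Tr}_m^{mn}(\delta)=0$. Let $f_1(x)$ be a polynomial over $\mathbb{F}_{p^{mn}}$ and $\varphi(x)$ a polynomial over $\mathbb{F}_{p^m}$ such that (i) $\mathrm{Tr}_m^{mn}(f_1(x)) = \varphi(\mathrm{Tr}_m^{mn}(x))$ for all $x\in\mathbb{F}_{p^{mn}}$, and (ii) for every $a \in \mathbb{F}_{p^m}$, $f_1$ is injective on the preimage $\{x \in \mathbb{F}_{p^{mn}} : \mathrm{Tr}_m^{mn}(x)=a\}$. Let $k$ be a positive integer and, for $1\le i\le k$, let $b_i \in \mathbb{F}_{p^m}$ and let $s_i$ be positive integers. Put $$f(x)=\sum_{i=1}^k b_i\left(\mathrm{Tr}_m^{mn}(x)+\delta\right)^{1+s_i(p^{nm}-1)/d}+f_1(x).$$ Then $f$ permutes $\mathbb{F}_{p^{nm}}$ if and only if $\varphi$ permutes $\mathbb{F}_{p^m}$. Moreover, suppose $f$ permutes $\mathbb{F}_{p^{nm}}$ and there exist polynomials $\phi(x)$, $\bar\phi(x)$ over $\mathbb{F}_{p^{nm}}$ such that $\Psi(x):=\phi(f_1(x))+\bar\phi(\mathrm{Tr}_m^{mn}(x))$ permutes $\mathbb{F}_{p^{nm}}$. Let $h(x)=\sum_{i=1}^k b_i(x+\delta)^{1+s_i(p^{nm}-1)/d}$, let $\varphi^{ -1}$ be the compositional inverse of $\varphi$ on $\mathbb{F}_{p^m}$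 and $\Psi^{ -1}$ the compositional inverse of $\Psi$ on $\mathbb{F}_{p^{nm}}$. Then the compositional inverse of $f$ over $\mathbb{F}_{p^{nm}}$ is $$f^{ -1}(x)=\Psi^{ -1}\Big(\phi\big(x-h(\varphi^{ -1}(\mathrm{Tr}_m^{mn}(x)))\big)+\bar\phi\big(\varphi^{ -1}(\mathrm{Tr}_m^{mn}(x))\big)\Big).$$
   Context: For positive integers $m \mid N$, $\mathrm{Tr}_m^{N}:\mathbb{F}_{p^N}\to\mathbb{F}_{p^m}$ is the trace map $\mathrm{Tr}_m^N(x)=\sum_{j=0}^{N/m-1}x^{p^{jm}}$. The compositional inverse of a permutation polynomial $F$ of a finite field $\mathbb{F}$ is the unique polynomial map $F^{ -1}$ on $\mathbb{F}$ with $F(F^{ -1}(x))=F^{ -1}(F(x))=x$ for all $x\in\mathbb{F}$. -}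

module Defs where

open import Data.Nat using (ℕ; zero; suc; _^_; _∸_; NonZero) renaming (_+_ to _+ℕ_; _*_ to _*ℕ_)
open import Data.Nat.DivMod using (_/_)
open import Data.Fin using (Fin)
open import Data.Product using (Σ; ∃; _×_)
open import Relation.Binary.PropositionalEquality using (_≡_; _≢_)
open import Algebra.Structures using (IsCommutativeRing)

record FiniteField (q : ℕ) : Set₁ where
  infixl 6 _+ᶠ_
  infixl 7 _*ᶠ_
  field
    Carrier : Set
    _+ᶠ_ _*ᶠ_ : Carrier → Carrier → Carrier
    -ᶠ_ : Carrier → Carrier
    0ᶠ 1ᶠ : Carrier
    isCommutativeRing : IsCommutativeRing _≡_ _+ᶠ_ _*ᶠ_ -ᶠ_ 0ᶠ 1ᶠ
    0≢1 : 0ᶠ ≢ 1ᶠ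
    inverse : ∀ x → x ≢ 0ᶠ → Σ Carrier (λ y → x *ᶠ y ≡ 1ᶠ)
    enum : Fin q → Carrier
    enum-injective : ∀ i j → enum i ≡ enum j → i ≡ j
    enum-surjective : ∀ x → Σ (Fin q) (λ i → enum i ≡ x)

module FF {q : ℕ} (F : FiniteField q) where
  open FiniteField F

  _-ᶠ_ : Carrier → Carrier → Carrier
  x -ᶠ y = x +ᶠ (-ᶠ y)

  pow : Carrier → ℕ → Carrier
  pow x zero = 1ᶠ
  pow x (suc e) = x *ᶠ pow x e

  sumℕ : ℕ → (ℕ → Carrier) → Carrier
  sumℕ zero g = 0ᶠ
  sumℕ (suc r) g = sumℕ r g +ᶠ g r

  sumFin : (k : ℕ) → (Fin k → Carrier) → Carrier
  sumFin zero g = 0ᶠ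
  sumFin (suc k) g = g Fin.zero +ᶠ sumFin k (λ i → g (Fin.suc i))

  Tr : (p m n : ℕ) → Carrier → Carrier
  Tr p m n x = sumℕ n (λ j → pow x (p ^ (j *ℕ m)))

  -- membership in the subfield F_{p^m} = {a : a^{p^m} = a}
  InSub : (p m : ℕ) → Carrier → Set
  InSub p m a = pow a (p ^ m) ≡ a

  hfun : (p n m d : ℕ) → .{{NonZero d}} → Carrier → (k : ℕ) → (Fin k → Carrier) → (Fin k → ℕ)
       → Carrier → Carrier
  hfun p n m d δ k b s x =
    sumFin k (λ i → b i *ᶠ pow (x +ᶠ δ) (1 +ℕ s i *ℕ ((p ^ (n *ℕ m) ∸ 1) / d)))

  ffun : (p n m d : ℕ) → .{{NonZero d}} → Carrier → (k : ℕ) → (Fin k → Carrier) → (Fin k → ℕ)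
       → (Carrier → Carrier) → Carrier → Carrier
  ffun p n m d δ k b s f1 x = hfun p n m d δ k b s (Tr p m n x) +ᶠ f1 x

  PermutesOn : (Carrier → Set) → (Carrier → Carrier) → Set
  PermutesOn S g = (∀ x → S x → S (g x))
                 × (∀ x y → S x → S y → g x ≡ g y → x ≡ y)
                 × (∀ y → S y → Σ Carrier (λ x → S x × g x ≡ y))

  Permutes : (Carrier → Carrier) → Set
  Permutes g = (∀ x y → g x ≡ g y → x ≡ y) × (∀ y → Σ Carrier (λ x → g x ≡ y))

  IsInverseOn : (Carrier → Set) → (Carrier → Carrier) → (Carrier → Carrier) → Set
  IsInverseOn S g ginv = (∀ a → S a → S (ginv a))
                       × (∀ a → S a → g (ginv a) ≡ a)
                       × (∀ a → S a → ginv (g a) ≡ a)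

  IsInverse : (Carrier → Carrier) → (Carrier → Carrier) → Set
  IsInverse g ginv = (∀ x → g (ginv x) ≡ x) × (∀ x → ginv (g x) ≡ x)

{-# OPTIONS --safe #-}
module Submission where

-- The trace Tr = Tr_m^{mn} is additive and F_{p^m}-linear (Frobenius), takes values in F_{p^m}
-- (since x ^ p^{mn} = x) and vanishes on F_{p^m} because p ∣ n. It maps onto F_{p^m}: as a polynomial
-- of degree p^{(n-1)m} < p^{mn} with leading coefficient 1 it has a non-root in the field. As
-- d ∣ p^m - 1, every z ^ ((p^{mn} - 1) / d) lies in F_{p^m}, so Tr kills each summand of h (a) when
-- a ∈ F_{p^m}, since Tr (a + δ) = 0; hence Tr ∘ f = φ ∘ Tr. Because f₁, and therefore f, is injective
-- on the fibres of Tr, finiteness gives: f permutes the field iff φ permutes F_{p^m}. For the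
-- inverse, φ⁻¹ (Tr (f x)) = Tr x and f x - h (Tr x) = f₁ x, so the formula returns Ψ⁻¹ (Ψ x) = x.

open import Defs
open import Data.Nat using (ℕ; _^_; _∸_; _<_; NonZero) renaming (_*_ to _*ℕ_)
open import Data.Nat.Divisibility using (_∣_)
open import Data.Nat.Primality using (Prime)
open import Data.Fin using (Fin)
open import Data.Product using (_×_)
open import Function.Bundles using (_⇔_)
open import Relation.Binary.PropositionalEquality using (_≡_)

open import Data.Nat as ℕ using (zero; suc; _+_; _≤_; _<′_; ≤′-refl; ≤′-step; pred; z≤n; s≤s; _!; nonTrivial⇒n>1)
import Data.Nat.Properties as ℕₚ
open import Data.Nat.Divisibility using (_∤_; divides; ∣-trans; ∣⇒≤; m∣m*n; ∣m∣n⇒∣m+n)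
open import Data.Nat.DivMod using (_/_; m/n*n≡m)
open import Data.Nat.Primality using (euclidsLemma; prime⇒nonTrivial; prime⇒nonZero)
open import Data.Nat.Combinatorics using (_C_; nCn≡1; nCk≡n!/k![n-k]!; k![n∸k]!∣n!)
open import Data.Fin as Fin using (punchOut)
import Data.Fin.Properties as Finₚ
open import Data.Fin.Permutation using (Permutation; permutation)
open import Data.Vec.Functional using (replicate; removeAt; init; last; tail)
open import Data.Product using (∃; _,_; proj₁; proj₂)
open import Data.Sum using (inj₁; inj₂)
open import Data.Empty using (⊥-elim)
open import Function using (id; _∘_)
open import Function.Bundles using (mk⇔)
open import Function.Definitions using (Injective)
open import Relation.Nullary using (¬_; yes; no; contradiction)
import Relation.Nullary.Decidable as Dec
open import Relation.Unary using (Decidable)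
open import Relation.Binary.Definitions using (DecidableEquality)
open import Relation.Binary.PropositionalEquality using (_≢_; refl; sym; trans; cong; cong₂; subst; module ≡-Reasoning)
open import Algebra.Core using (Op₂)
open import Algebra.Bundles using (CommutativeMonoid; CommutativeRing)
open import Algebra.Structures using (IsCommutativeMonoid)
import Algebra.Properties.AbelianGroup as AbelianGroupProperties
import Algebra.Properties.CommutativeMonoid.Sum as CommutativeMonoidSum

prime>1 : ∀ {p} → Prime p → 1 < p
prime>1 {p} pr = nonTrivial⇒n>1 p {{prime⇒nonTrivial pr}}

prime∤! : ∀ {p} → Prime p → ∀ {j} → j < p → p ∤ j !
prime∤! pr {zero} _ p∣1 = ℕₚ.<⇒≱ (prime>1 pr) (∣⇒≤ p∣1)
prime∤! pr {suc j} j<p p∣ with euclidsLemma (suc j) (j !) pr p∣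
... | inj₁ p∣1+j = ℕₚ.<⇒≱ j<p (∣⇒≤ p∣1+j)
... | inj₂ p∣j! = prime∤! pr (ℕₚ.<-trans (ℕₚ.n<1+n j) j<p) p∣j!

n∣n! : ∀ {n} → 0 < n → n ∣ n !
n∣n! {suc n} _ = m∣m*n (n !)

nCk*k!*[n∸k]!≡n! : ∀ {n k} → k ≤ n → (n C k) *ℕ (k ! *ℕ (n ∸ k) !) ≡ n !
nCk*k!*[n∸k]!≡n! {n} {k} k≤n =
  trans (cong (_*ℕ (k ! *ℕ (n ∸ k) !)) (nCk≡n!/k![n-k]! k≤n)) (m/n*n≡m (k![n∸k]!∣n! k≤n))
  where
  instance
    k!*[n∸k]!≢0 : NonZero (k ! *ℕ (n ∸ k) !)
    k!*[n∸k]!≢0 = ℕₚ._!*_!≢0 k (n ∸ k)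

prime∣C : ∀ {p k} → Prime p → 0 < k → k < p → p ∣ p C k
prime∣C {p} {k} pr 0<k k<p with euclidsLemma (p C k) (k ! *ℕ (p ∸ k) !) pr
  (subst (p ∣_) (sym (nCk*k!*[n∸k]!≡n! (ℕₚ.<⇒≤ k<p))) (n∣n! (ℕₚ.<-trans 0<k k<p)))
... | inj₁ p∣C = p∣C
... | inj₂ p∣k!*[p∸k]! with euclidsLemma (k !) ((p ∸ k) !) pr p∣k!*[p∸k]!
...   | inj₁ p∣k! = contradiction p∣k! (prime∤! pr k<p)
...   | inj₂ p∣[p∸k]! = contradiction p∣[p∸k]! (prime∤! pr (ℕₚ.∸-monoʳ-< 0<k (ℕₚ.<⇒≤ k<p)))

pred∣pred^ : ∀ x n → x ∸ 1 ∣ x ^ n ∸ 1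
pred∣pred^ zero zero = divides 0 refl
pred∣pred^ zero (suc n) = divides 0 refl
pred∣pred^ (suc x) zero = divides 0 refl
pred∣pred^ (suc x) (suc n) =
  subst (x ∣_) (sym (ℕₚ.+-∸-comm (x *ℕ suc x ^ n) (ℕₚ.m^n>0 (suc x) n)))
    (∣m∣n⇒∣m+n (pred∣pred^ (suc x) n) (m∣m*n (suc x ^ n)))

Fin-injective⇒surjective : ∀ {N} (f : Fin N → Fin N) → Injective _≡_ _≡_ f → ∀ y → ∃ λ x → f x ≡ y
Fin-injective⇒surjective {suc N} f f-inj y with Finₚ.any? (λ x → f x Finₚ.≟ y)
... | yes hit = hit
... | no miss = ⊥-elim (Finₚ.<⇒notInjective (ℕₚ.n<1+n N) g-inj)
  where
  y≢f : ∀ x → y ≢ f x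
  y≢f x y≡fx = miss (x , sym y≡fx)
  g : Fin (suc N) → Fin N
  g x = punchOut (y≢f x)
  g-inj : Injective _≡_ _≡_ g
  g-inj gx≡gx′ = f-inj (Finₚ.punchOut-injective (y≢f _) (y≢f _) gx≡gx′)

Fin-surjective⇒injective : ∀ {N} (f : Fin N → Fin N) → (∀ y → ∃ λ x → f x ≡ y) → Injective _≡_ _≡_ f
Fin-surjective⇒injective {N} f f-surj {x} {x′} fx≡fx′ = trans (sym (g∘f≡id x)) (trans (cong g fx≡fx′) (g∘f≡id x′))
  where
  g : Fin N → Fin N
  g y = proj₁ (f-surj y)
  f∘g≡id : ∀ y → f (g y) ≡ y
  f∘g≡id y = proj₂ (f-surj y)
  g-inj : Injective _≡_ _≡_ g
  g-inj {y} {y′} gy≡gy′ = trans (sym (f∘g≡id y)) (trans (cong f gy≡gy′) (f∘g≡id y′))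
  g∘f≡id : ∀ x → g (f x) ≡ x
  g∘f≡id x with Fin-injective⇒surjective g g-inj x
  ... | y , refl = cong g (f∘g≡id y)

module FiniteFieldProperties {q : ℕ} (F : FiniteField q) where
  open FiniteField F
  open FF F

  commutativeRing : CommutativeRing _ _
  commutativeRing = record { Carrier = Carrier ; _≈_ = _≡_ ; _+_ = _+ᶠ_ ; _*_ = _*ᶠ_ ; -_ = -ᶠ_
                           ; 0# = 0ᶠ ; 1# = 1ᶠ ; isCommutativeRing = isCommutativeRing }

  module R = CommutativeRing commutativeRing
  module +-Group = AbelianGroupProperties R.+-abelianGroup
  open import Algebra.Properties.Ring R.ring using (x[y-z]≈xy-xz)
  open import Algebra.Properties.CommutativeSemigroup R.*-commutativeSemigroup using (x∙yz≈y∙xz)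
  open import Algebra.Properties.Semiring.Exp R.semiring using (^-assocʳ) renaming (_^_ to _^ᶠ_)
  open import Algebra.Properties.CommutativeSemiring.Exp R.commutativeSemiring using (^-distrib-*)
  open import Algebra.Properties.Semiring.Mult R.semiring using (×1-homo-*; ×-assoc-*) renaming (_×_ to _×ᶠ_)
  import Algebra.Properties.CommutativeSemiring.Binomial R.commutativeSemiring as Binomial
  open import Algebra.Solver.Ring.NaturalCoefficients.Default R.commutativeSemiring
    using (solve; _:=_; _:+_; _:*_)

  index : Carrier → Fin q
  index x = proj₁ (enum-surjective x)

  enum∘index : ∀ x → enum (index x) ≡ x
  enum∘index x = proj₂ (enum-surjective x)

  index∘enum : ∀ i → index (enum i) ≡ i
  index∘enum i = enum-injective _ _ (enum∘index (enum i))

  index-injective : ∀ {x y} → index x ≡ index y → x ≡ y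
  index-injective {x} {y} eq = trans (sym (enum∘index x)) (trans (cong enum eq) (enum∘index y))

  _≟_ : DecidableEquality Carrier
  x ≟ y = Dec.map′ index-injective (cong index) (index x Finₚ.≟ index y)

  onFin : (Carrier → Carrier) → Fin q → Fin q
  onFin g i = index (g (enum i))

  onFin-inverse : ∀ f f⁻¹ → (∀ x → f (f⁻¹ x) ≡ x) → ∀ i → onFin f (onFin f⁻¹ i) ≡ i
  onFin-inverse f f⁻¹ ff⁻¹ i =
    trans (cong (index ∘ f) (enum∘index _)) (trans (cong index (ff⁻¹ (enum i))) (index∘enum i))

  injective⇒surjective : (g : Carrier → Carrier) → (∀ x y → g x ≡ g y → x ≡ y) → ∀ y → ∃ λ x → g x ≡ y
  injective⇒surjective g g-inj y with Fin-injective⇒surjective (onFin g) onFin-inj (index y)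
    where
    onFin-inj : ∀ {i j} → onFin g i ≡ onFin g j → i ≡ j
    onFin-inj eq = enum-injective _ _ (g-inj _ _ (index-injective eq))
  ... | i , gi≡y = enum i , index-injective gi≡y

  surjective⇒injective : (g : Carrier → Carrier) → (∀ y → ∃ λ x → g x ≡ y) → ∀ x y → g x ≡ g y → x ≡ y
  surjective⇒injective g g-surj x y gx≡gy = index-injective (Fin-surjective⇒injective (onFin g) onFin-surj
    (cong index (trans (cong g (enum∘index x)) (trans gx≡gy (sym (cong g (enum∘index y)))))))
    where
    onFin-surj : ∀ j → ∃ λ i → onFin g i ≡ j
    onFin-surj j with g-surj (enum j)
    ... | z , gz≡j = index z , trans (cong (index ∘ g) (enum∘index z)) (trans (cong index gz≡j) (index∘enum j))

  x≢0⇒xy≡0⇒y≡0 : ∀ {x y} → x ≢ 0ᶠ → x *ᶠ y ≡ 0ᶠ → y ≡ 0ᶠ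
  x≢0⇒xy≡0⇒y≡0 {x} {y} x≢0 xy≡0 with inverse x x≢0
  ... | x⁻¹ , xx⁻¹≡1 = begin
    y                  ≡⟨ R.*-identityʳ y ⟨
    y *ᶠ 1ᶠ            ≡⟨ cong (y *ᶠ_) xx⁻¹≡1 ⟨
    y *ᶠ (x *ᶠ x⁻¹)    ≡⟨ solve 3 (λ x x⁻¹ y → y :* (x :* x⁻¹) := (x :* y) :* x⁻¹) refl x x⁻¹ y ⟩
    (x *ᶠ y) *ᶠ x⁻¹    ≡⟨ cong (_*ᶠ x⁻¹) xy≡0 ⟩
    0ᶠ *ᶠ x⁻¹          ≡⟨ R.zeroˡ x⁻¹ ⟩
    0ᶠ                 ∎
    where open ≡-Reasoning

  *-cancelˡ-≢0 : ∀ {x y z} → x ≢ 0ᶠ → x *ᶠ y ≡ x *ᶠ z → y ≡ z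
  *-cancelˡ-≢0 {x} {y} {z} x≢0 xy≡xz = +-Group.x∙y⁻¹≈ε⇒x≈y y z
    (x≢0⇒xy≡0⇒y≡0 x≢0 (trans (x[y-z]≈xy-xz x y z) (+-Group.x≈y⇒x∙y⁻¹≈ε xy≡xz)))

  ≢⇒*≡*⇒≡0 : ∀ {a b k} → a ≢ b → a *ᶠ k ≡ b *ᶠ k → k ≡ 0ᶠ
  ≢⇒*≡*⇒≡0 {a} {b} {k} a≢b ak≡bk with k ≟ 0ᶠ
  ... | yes k≡0 = k≡0
  ... | no k≢0 = contradiction (*-cancelˡ-≢0 k≢0 (trans (R.*-comm k a) (trans ak≡bk (R.*-comm b k)))) a≢b

  pow≗^ : ∀ x n → pow x n ≡ x ^ᶠ n
  pow≗^ x zero = refl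
  pow≗^ x (suc n) = cong (x *ᶠ_) (pow≗^ x n)

  pow-* : ∀ x a b → pow x (a *ℕ b) ≡ pow (pow x a) b
  pow-* x a b = begin
    pow x (a *ℕ b)   ≡⟨ pow≗^ x (a *ℕ b) ⟩
    x ^ᶠ (a *ℕ b)    ≡⟨ ^-assocʳ x a b ⟨
    (x ^ᶠ a) ^ᶠ b    ≡⟨ cong (_^ᶠ b) (pow≗^ x a) ⟨
    pow x a ^ᶠ b     ≡⟨ pow≗^ (pow x a) b ⟨
    pow (pow x a) b  ∎
    where open ≡-Reasoning

  pow-distrib-* : ∀ x y n → pow (x *ᶠ y) n ≡ pow x n *ᶠ pow y n
  pow-distrib-* x y n = begin
    pow (x *ᶠ y) n      ≡⟨ pow≗^ (x *ᶠ y) n ⟩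
    (x *ᶠ y) ^ᶠ n       ≡⟨ ^-distrib-* x y n ⟩
    x ^ᶠ n *ᶠ y ^ᶠ n    ≡⟨ cong₂ _*ᶠ_ (pow≗^ x n) (pow≗^ y n) ⟨
    pow x n *ᶠ pow y n  ∎
    where open ≡-Reasoning

  pow-1ᶠ : ∀ n → pow 1ᶠ n ≡ 1ᶠ
  pow-1ᶠ zero = refl
  pow-1ᶠ (suc n) = trans (R.*-identityˡ _) (pow-1ᶠ n)

  pow-0ᶠ : ∀ n → .{{NonZero n}} → pow 0ᶠ n ≡ 0ᶠ
  pow-0ᶠ (suc n) = R.zeroˡ _

  pow≡0⇒≡0 : ∀ x n → pow x n ≡ 0ᶠ → x ≡ 0ᶠ
  pow≡0⇒≡0 x zero 1≡0 = contradiction (sym 1≡0) 0≢1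
  pow≡0⇒≡0 x (suc n) xⁿ⁺¹≡0 with x ≟ 0ᶠ
  ... | yes x≡0 = x≡0
  ... | no x≢0 = pow≡0⇒≡0 x n (x≢0⇒xy≡0⇒y≡0 x≢0 xⁿ⁺¹≡0)

  module Reindex {_∙_ : Op₂ Carrier} {ε : Carrier} (isCM : IsCommutativeMonoid _≡_ _∙_ ε) where
    commutativeMonoid : CommutativeMonoid _ _
    commutativeMonoid = record { isCommutativeMonoid = isCM }

    open CommutativeMonoidSum commutativeMonoid public

    sum-reindex : (g σ σ⁻¹ : Carrier → Carrier) → (∀ x → σ (σ⁻¹ x) ≡ x) → (∀ x → σ⁻¹ (σ x) ≡ x)
              → sum (g ∘ enum) ≡ sum (g ∘ σ ∘ enum)
    sum-reindex g σ σ⁻¹ σσ⁻¹ σ⁻¹σ = trans (∑-permute (g ∘ enum) π)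
      (sum-cong-≗ (λ i → cong g (enum∘index (σ (enum i)))))
      where
      π : Permutation q q
      π = permutation (onFin σ) (onFin σ⁻¹) (onFin-inverse σ σ⁻¹ σσ⁻¹) (onFin-inverse σ⁻¹ σ σ⁻¹σ)

  module ∑ = Reindex R.+-isCommutativeMonoid
  module ∏ = Reindex R.*-isCommutativeMonoid

  -- Translation by 1 permutes the field, so ∑ y = ∑ (y + 1) = ∑ y + q · 1.
  q×1≡0 : q ×ᶠ 1ᶠ ≡ 0ᶠ
  q×1≡0 = +-Group.identityʳ-unique total (q ×ᶠ 1ᶠ) (sym (begin
    total                            ≡⟨ ∑.sum-reindex id (_+ᶠ 1ᶠ) (_-ᶠ 1ᶠ) [y-1]+1≡y [y+1]-1≡y ⟩
    ∑.sum (λ i → enum i +ᶠ 1ᶠ)       ≡⟨ ∑.∑-distrib-+ enum (λ _ → 1ᶠ) ⟩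
    total +ᶠ ∑.sum (replicate q 1ᶠ)  ≡⟨ cong (total +ᶠ_) (∑.sum-replicate q) ⟩
    total +ᶠ q ×ᶠ 1ᶠ                 ∎))
    where
    open ≡-Reasoning
    total : Carrier
    total = ∑.sum enum
    [y-1]+1≡y : ∀ y → (y -ᶠ 1ᶠ) +ᶠ 1ᶠ ≡ y
    [y-1]+1≡y = +-Group.//-rightDividesˡ 1ᶠ
    [y+1]-1≡y : ∀ y → (y +ᶠ 1ᶠ) -ᶠ 1ᶠ ≡ y
    [y+1]-1≡y = +-Group.//-rightDividesʳ 1ᶠ

  n×x≡[n×1]*x : ∀ n x → n ×ᶠ x ≡ (n ×ᶠ 1ᶠ) *ᶠ x
  n×x≡[n×1]*x n x = trans (cong (n ×ᶠ_) (sym (R.*-identityˡ x))) (sym (×-assoc-* n 1ᶠ x))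

  ×1-homo-pow : ∀ a e → (a ^ e) ×ᶠ 1ᶠ ≡ pow (a ×ᶠ 1ᶠ) e
  ×1-homo-pow a zero = R.+-identityʳ 1ᶠ
  ×1-homo-pow a (suc e) = trans (×1-homo-* a (a ^ e)) (cong ((a ×ᶠ 1ᶠ) *ᶠ_) (×1-homo-pow a e))

  characteristic : ∀ p e → q ≡ p ^ e → p ×ᶠ 1ᶠ ≡ 0ᶠ
  characteristic p e refl = pow≡0⇒≡0 (p ×ᶠ 1ᶠ) e (trans (sym (×1-homo-pow p e)) q×1≡0)

  ∣⇒×≡0 : ∀ {p k} → p ×ᶠ 1ᶠ ≡ 0ᶠ → p ∣ k → ∀ x → k ×ᶠ x ≡ 0ᶠ
  ∣⇒×≡0 {p} p×1≡0 (divides r refl) x = begin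
    (r *ℕ p) ×ᶠ x                  ≡⟨ n×x≡[n×1]*x (r *ℕ p) x ⟩
    ((r *ℕ p) ×ᶠ 1ᶠ) *ᶠ x          ≡⟨ cong (_*ᶠ x) (×1-homo-* r p) ⟩
    ((r ×ᶠ 1ᶠ) *ᶠ (p ×ᶠ 1ᶠ)) *ᶠ x  ≡⟨ cong (λ c → ((r ×ᶠ 1ᶠ) *ᶠ c) *ᶠ x) p×1≡0 ⟩
    ((r ×ᶠ 1ᶠ) *ᶠ 0ᶠ) *ᶠ x         ≡⟨ cong (_*ᶠ x) (R.zeroʳ _) ⟩
    0ᶠ *ᶠ x                        ≡⟨ R.zeroˡ x ⟩
    0ᶠ                             ∎
    where open ≡-Reasoning

  instance
    q≢0 : NonZero q
    q≢0 = Finₚ.nonZeroIndex (index 0ᶠ)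

  ∏≢0 : ∀ {N} (f : Fin N → Carrier) → (∀ i → f i ≢ 0ᶠ) → ∏.sum f ≢ 0ᶠ
  ∏≢0 {zero} f f≢0 = 0≢1 ∘ sym
  ∏≢0 {suc N} f f≢0 ∏f≡0 with f Fin.zero ≟ 0ᶠ
  ... | yes f₀≡0 = f≢0 Fin.zero f₀≡0
  ... | no f₀≢0 = ∏≢0 (f ∘ Fin.suc) (f≢0 ∘ Fin.suc) (x≢0⇒xy≡0⇒y≡0 f₀≢0 ∏f≡0)

  ∏-agreeing-except : ∀ {N} (f g : Fin N → Carrier) (i₀ : Fin N) → (∀ i → i ≢ i₀ → f i ≡ g i)
                    → f i₀ *ᶠ ∏.sum g ≡ g i₀ *ᶠ ∏.sum f
  ∏-agreeing-except {suc N} f g i₀ f≡g = begin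
    f i₀ *ᶠ ∏.sum g                          ≡⟨ cong (f i₀ *ᶠ_) (∏.sum-remove {i = i₀} g) ⟩
    f i₀ *ᶠ (g i₀ *ᶠ ∏.sum (removeAt g i₀))  ≡⟨ cong (λ r → f i₀ *ᶠ (g i₀ *ᶠ r)) rest ⟨
    f i₀ *ᶠ (g i₀ *ᶠ ∏.sum (removeAt f i₀))  ≡⟨ x∙yz≈y∙xz (f i₀) (g i₀) _ ⟩
    g i₀ *ᶠ (f i₀ *ᶠ ∏.sum (removeAt f i₀))  ≡⟨ cong (g i₀ *ᶠ_) (∏.sum-remove {i = i₀} f) ⟨
    g i₀ *ᶠ ∏.sum f                          ∎
    where
    open ≡-Reasoning
    rest : ∏.sum (removeAt f i₀) ≡ ∏.sum (removeAt g i₀)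
    rest = ∏.sum-cong-≗ (λ j → f≡g (Fin.punchIn i₀ j) (Finₚ.punchInᵢ≢i i₀ j))

  0↦1 : Carrier → Carrier
  0↦1 y with y ≟ 0ᶠ
  ... | yes _ = 1ᶠ
  ... | no _ = y

  0↦1-0 : 0↦1 0ᶠ ≡ 1ᶠ
  0↦1-0 with 0ᶠ ≟ 0ᶠ
  ... | yes _ = refl
  ... | no 0≢0 = contradiction refl 0≢0

  0↦1-≢0 : ∀ {y} → y ≢ 0ᶠ → 0↦1 y ≡ y
  0↦1-≢0 {y} y≢0 with y ≟ 0ᶠ
  ... | yes y≡0 = contradiction y≡0 y≢0
  ... | no _ = refl

  0↦1≢0 : ∀ y → 0↦1 y ≢ 0ᶠ
  0↦1≢0 y with y ≟ 0ᶠ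
  ... | yes _ = 0≢1 ∘ sym
  ... | no y≢0 = y≢0

  ∏-scale-invariant : ∀ {x} → x ≢ 0ᶠ → (g : Carrier → Carrier) → ∏.sum (g ∘ (x *ᶠ_) ∘ enum) ≡ ∏.sum (g ∘ enum)
  ∏-scale-invariant {x} x≢0 g with inverse x x≢0
  ... | x⁻¹ , xx⁻¹≡1 = sym (∏.sum-reindex g (x *ᶠ_) (x⁻¹ *ᶠ_) (cancel x x⁻¹ xx⁻¹≡1) (cancel x⁻¹ x x⁻¹x≡1))
    where
    x⁻¹x≡1 : x⁻¹ *ᶠ x ≡ 1ᶠ
    x⁻¹x≡1 = trans (R.*-comm x⁻¹ x) xx⁻¹≡1
    cancel : ∀ a b → a *ᶠ b ≡ 1ᶠ → ∀ y → a *ᶠ (b *ᶠ y) ≡ y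
    cancel a b ab≡1 y = trans (sym (R.*-assoc a b y)) (trans (cong (_*ᶠ y) ab≡1) (R.*-identityˡ y))

  0↦1-* : ∀ {x y} → x ≢ 0ᶠ → y ≢ 0ᶠ → 0↦1 (x *ᶠ y) ≡ x *ᶠ 0↦1 y
  0↦1-* x≢0 y≢0 = trans (0↦1-≢0 (y≢0 ∘ x≢0⇒xy≡0⇒y≡0 x≢0)) (cong (_ *ᶠ_) (sym (0↦1-≢0 y≢0)))

  -- y ↦ x y permutes the field and, away from y = 0, multiplies 0↦1 y by x.
  fermat : ∀ x → pow x q ≡ x
  fermat x with x ≟ 0ᶠ
  ... | yes refl = pow-0ᶠ q
  ... | no x≢0 = *-cancelˡ-≢0 (∏≢0 (0↦1 ∘ enum) (0↦1≢0 ∘ enum)) (begin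
    P *ᶠ pow x q                           ≡⟨ R.*-comm P _ ⟩
    pow x q *ᶠ P                           ≡⟨ cong (_*ᶠ P) (pow≗^ x q) ⟩
    x ^ᶠ q *ᶠ P                            ≡⟨ cong (_*ᶠ P) (∏.sum-replicate q) ⟨
    ∏.sum (replicate q x) *ᶠ P             ≡⟨ ∏.∑-distrib-+ (replicate q x) (0↦1 ∘ enum) ⟨
    xP                                     ≡⟨ R.*-identityˡ xP ⟨
    1ᶠ *ᶠ xP                               ≡⟨ cong (_*ᶠ xP) 0↦1[x*e₀]≡1 ⟨
    0↦1 (x *ᶠ enum i₀) *ᶠ xP               ≡⟨ ∏-agreeing-except _ _ i₀ agree ⟩
    (x *ᶠ 0↦1 (enum i₀)) *ᶠ ∏.sum (0↦1 ∘ (x *ᶠ_) ∘ enum)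
                                           ≡⟨ cong₂ _*ᶠ_ x*0↦1[e₀]≡x (∏-scale-invariant x≢0 0↦1) ⟩
    x *ᶠ P                                 ≡⟨ R.*-comm x P ⟩
    P *ᶠ x                                 ∎)
    where
    open ≡-Reasoning
    P xP : Carrier
    P = ∏.sum (0↦1 ∘ enum)
    xP = ∏.sum (λ i → x *ᶠ 0↦1 (enum i))
    i₀ : Fin q
    i₀ = index 0ᶠ
    0↦1[x*e₀]≡1 : 0↦1 (x *ᶠ enum i₀) ≡ 1ᶠ
    0↦1[x*e₀]≡1 = trans (cong (λ y → 0↦1 (x *ᶠ y)) (enum∘index 0ᶠ)) (trans (cong 0↦1 (R.zeroʳ x)) 0↦1-0)
    x*0↦1[e₀]≡x : x *ᶠ 0↦1 (enum i₀) ≡ x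
    x*0↦1[e₀]≡x = trans (cong (λ y → x *ᶠ 0↦1 y) (enum∘index 0ᶠ)) (trans (cong (x *ᶠ_) 0↦1-0) (R.*-identityʳ x))
    agree : ∀ i → i ≢ i₀ → 0↦1 (x *ᶠ enum i) ≡ x *ᶠ 0↦1 (enum i)
    agree i i≢i₀ = 0↦1-* x≢0 (λ eᵢ≡0 → i≢i₀ (trans (sym (index∘enum i)) (cong index eᵢ≡0)))

  fermat-pred : ∀ {x} → x ≢ 0ᶠ → pow x (q ∸ 1) ≡ 1ᶠ
  fermat-pred {x} x≢0 = *-cancelˡ-≢0 x≢0 (begin
    x *ᶠ pow x (q ∸ 1)  ≡⟨ cong (pow x) (trans (ℕₚ.+-comm 1 (q ∸ 1)) (ℕₚ.m∸n+n≡m (ℕ.>-nonZero⁻¹ q))) ⟩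
    pow x q             ≡⟨ fermat x ⟩
    x                   ≡⟨ R.*-identityʳ x ⟨
    x *ᶠ 1ᶠ             ∎)
    where open ≡-Reasoning

  freshmans-dream : ∀ n .{{_ : NonZero n}} → (∀ {k} → 0 < k → k < n → ∀ x → (n C k) ×ᶠ x ≡ 0ᶠ)
                  → ∀ x y → pow (x +ᶠ y) n ≡ pow x n +ᶠ pow y n
  freshmans-dream (suc N) inner x y = begin
    pow (x +ᶠ y) (suc N)                                    ≡⟨ pow≗^ (x +ᶠ y) (suc N) ⟩
    (x +ᶠ y) ^ᶠ suc N                                       ≡⟨ Binomial.theorem (suc N) x y ⟩
    T Fin.zero +ᶠ ∑.sum (tail T)                            ≡⟨ cong (T Fin.zero +ᶠ_) (∑.sum-init-last (tail T)) ⟩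
    T Fin.zero +ᶠ (∑.sum (init (tail T)) +ᶠ last (tail T))  ≡⟨ cong (λ a → T Fin.zero +ᶠ (a +ᶠ last (tail T))) inner-vanish ⟩
    T Fin.zero +ᶠ (0ᶠ +ᶠ last (tail T))                     ≡⟨ cong (λ b → T Fin.zero +ᶠ (0ᶠ +ᶠ b)) last-term ⟩
    T Fin.zero +ᶠ (0ᶠ +ᶠ pow x (suc N))                     ≡⟨ cong₂ _+ᶠ_ first-term (R.+-identityˡ _) ⟩
    pow y (suc N) +ᶠ pow x (suc N)                          ≡⟨ R.+-comm _ _ ⟩
    pow x (suc N) +ᶠ pow y (suc N)                          ∎
    where
    open ≡-Reasoning
    T : Fin (suc (suc N)) → Carrier
    T = Binomial.binomialTerm x y (suc N)
    inner-vanish : ∑.sum (init (tail T)) ≡ 0ᶠ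
    inner-vanish = trans (∑.sum-cong-≗ (λ i → inner (s≤s z≤n) (s≤s (Finₚ.inject₁ℕ< i)) _)) (∑.sum-replicate-zero N)
    last-term : T (Fin.suc (Fin.fromℕ N)) ≡ pow x (suc N)
    last-term rewrite Finₚ.toℕ-fromℕ N | nCn≡1 (suc N) | ℕₚ.n∸n≡0 N =
      trans (R.+-identityʳ _) (trans (R.*-identityʳ _) (sym (pow≗^ x (suc N))))
    first-term : T Fin.zero ≡ pow y (suc N)
    first-term = trans (R.+-identityʳ _) (trans (R.*-identityˡ _) (sym (pow≗^ y (suc N))))

  module Frobenius {p : ℕ} (pr : Prime p) (p×1≡0 : p ×ᶠ 1ᶠ ≡ 0ᶠ) where
    instance
      p≢0 : NonZero p
      p≢0 = prime⇒nonZero pr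

    frobenius : ∀ x y → pow (x +ᶠ y) p ≡ pow x p +ᶠ pow y p
    frobenius = freshmans-dream p (λ 0<k k<p → ∣⇒×≡0 p×1≡0 (prime∣C pr 0<k k<p))

    frobenius^ : ∀ e x y → pow (x +ᶠ y) (p ^ e) ≡ pow x (p ^ e) +ᶠ pow y (p ^ e)
    frobenius^ zero x y = trans (R.*-identityʳ _) (sym (cong₂ _+ᶠ_ (R.*-identityʳ x) (R.*-identityʳ y)))
    frobenius^ (suc e) x y = begin
      pow (x +ᶠ y) (p *ℕ p ^ e)                       ≡⟨ pow-* (x +ᶠ y) p (p ^ e) ⟩
      pow (pow (x +ᶠ y) p) (p ^ e)                    ≡⟨ cong (λ z → pow z (p ^ e)) (frobenius x y) ⟩
      pow (pow x p +ᶠ pow y p) (p ^ e)                ≡⟨ frobenius^ e (pow x p) (pow y p) ⟩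
      pow (pow x p) (p ^ e) +ᶠ pow (pow y p) (p ^ e)  ≡⟨ cong₂ _+ᶠ_ (pow-* x p (p ^ e)) (pow-* y p (p ^ e)) ⟨
      pow x (p *ℕ p ^ e) +ᶠ pow y (p *ℕ p ^ e)        ∎
      where open ≡-Reasoning

    frobenius^-sumℕ : ∀ e r g → pow (sumℕ r g) (p ^ e) ≡ sumℕ r (λ j → pow (g j) (p ^ e))
    frobenius^-sumℕ e zero g = pow-0ᶠ (p ^ e) {{ℕₚ.m^n≢0 p e}}
    frobenius^-sumℕ e (suc r) g = trans (frobenius^ e _ _) (cong (_+ᶠ pow (g r) (p ^ e)) (frobenius^-sumℕ e r g))

  sumℕ-cong : ∀ r {g g′ : ℕ → Carrier} → (∀ j → g j ≡ g′ j) → sumℕ r g ≡ sumℕ r g′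
  sumℕ-cong zero g≗g′ = refl
  sumℕ-cong (suc r) g≗g′ = cong₂ _+ᶠ_ (sumℕ-cong r g≗g′) (g≗g′ r)

  sumℕ-+ : ∀ r (g g′ : ℕ → Carrier) → sumℕ r (λ j → g j +ᶠ g′ j) ≡ sumℕ r g +ᶠ sumℕ r g′
  sumℕ-+ zero g g′ = sym (R.+-identityʳ 0ᶠ)
  sumℕ-+ (suc r) g g′ = trans (cong (_+ᶠ (g r +ᶠ g′ r)) (sumℕ-+ r g g′))
    (solve 4 (λ a b c d → (a :+ b) :+ (c :+ d) := (a :+ c) :+ (b :+ d)) refl _ _ _ _)

  sumℕ-*ˡ : ∀ r c (g : ℕ → Carrier) → sumℕ r (λ j → c *ᶠ g j) ≡ c *ᶠ sumℕ r g
  sumℕ-*ˡ zero c g = sym (R.zeroʳ c)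
  sumℕ-*ˡ (suc r) c g = trans (cong (_+ᶠ c *ᶠ g r) (sumℕ-*ˡ r c g)) (sym (R.distribˡ c _ _))

  sumℕ-const : ∀ r c → sumℕ r (λ _ → c) ≡ r ×ᶠ c
  sumℕ-const zero c = refl
  sumℕ-const (suc r) c = trans (cong (_+ᶠ c) (sumℕ-const r c)) (R.+-comm _ c)

  sumℕ-rotate : ∀ r (g : ℕ → Carrier) → g r ≡ g 0 → sumℕ r (g ∘ suc) ≡ sumℕ r g
  sumℕ-rotate r g gᵣ≡g₀ = +-Group.∙-cancelˡ (g 0) _ _
    (trans (sym (sumℕ-uncons r)) (trans (cong (sumℕ r g +ᶠ_) gᵣ≡g₀) (R.+-comm _ _)))
    where
    sumℕ-uncons : ∀ r → sumℕ (suc r) g ≡ g 0 +ᶠ sumℕ r (g ∘ suc)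
    sumℕ-uncons zero = trans (R.+-identityˡ _) (sym (R.+-identityʳ _))
    sumℕ-uncons (suc r) = trans (cong (_+ᶠ g (suc r)) (sumℕ-uncons r)) (R.+-assoc _ _ _)

  -- Polynomial D c g: g is (pointwise) a polynomial function of degree at most D, given in
  -- Horner form, whose coefficient of x ^ D is c.
  data Polynomial : ℕ → Carrier → (Carrier → Carrier) → Set where
    const  : ∀ {c g} → (∀ x → g x ≡ c) → Polynomial 0 c g
    horner : ∀ {D c g} a h → Polynomial D c h → (∀ x → g x ≡ a +ᶠ x *ᶠ h x) → Polynomial (suc D) c g

  Polynomial-≗ : ∀ {D c g g′} → Polynomial D c g → (∀ x → g x ≡ g′ x) → Polynomial D c g′
  Polynomial-≗ (const g≡c) g≗g′ = const (λ x → trans (sym (g≗g′ x)) (g≡c x))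
  Polynomial-≗ (horner a h P g≡) g≗g′ = horner a h P (λ x → trans (sym (g≗g′ x)) (g≡ x))

  Polynomial-+ : ∀ {D c c′ g g′} → Polynomial D c g → Polynomial D c′ g′ → Polynomial D (c +ᶠ c′) (λ x → g x +ᶠ g′ x)
  Polynomial-+ (const g≡c) (const g′≡c′) = const (λ x → cong₂ _+ᶠ_ (g≡c x) (g′≡c′ x))
  Polynomial-+ (horner a h P g≡) (horner a′ h′ P′ g′≡) = horner (a +ᶠ a′) _ (Polynomial-+ P P′) (λ x →
    trans (cong₂ _+ᶠ_ (g≡ x) (g′≡ x))
      (solve 5 (λ a a′ x u v → (a :+ x :* u) :+ (a′ :+ x :* v) := (a :+ a′) :+ x :* (u :+ v)) refl a a′ x (h x) (h′ x)))

  Polynomial-0 : ∀ D → Polynomial D 0ᶠ (λ _ → 0ᶠ)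
  Polynomial-0 zero = const (λ _ → refl)
  Polynomial-0 (suc D) = horner 0ᶠ _ (Polynomial-0 D) (λ x → sym (trans (cong (0ᶠ +ᶠ_) (R.zeroʳ x)) (R.+-identityʳ 0ᶠ)))

  Polynomial-raise : ∀ {D c g} → Polynomial D c g → Polynomial (suc D) 0ᶠ g
  Polynomial-raise {c = c} (const g≡c) = horner c _ (Polynomial-0 0)
    (λ x → trans (g≡c x) (sym (trans (cong (c +ᶠ_) (R.zeroʳ x)) (R.+-identityʳ c))))
  Polynomial-raise (horner a h P g≡) = horner a h (Polynomial-raise P) g≡

  Polynomial-raise< : ∀ {D D′ c g} → Polynomial D c g → D <′ D′ → Polynomial D′ 0ᶠ g
  Polynomial-raise< P ≤′-refl = Polynomial-raise P
  Polynomial-raise< P (≤′-step D<D′) = Polynomial-raise (Polynomial-raise< P D<D′)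

  Polynomial-pow : ∀ e → Polynomial e 1ᶠ (λ x → pow x e)
  Polynomial-pow zero = const (λ _ → refl)
  Polynomial-pow (suc e) = horner 0ᶠ _ (Polynomial-pow e) (λ x → sym (R.+-identityˡ _))

  Polynomial-Tr : ∀ {p} → 1 < p → ∀ m .{{_ : NonZero m}} n′ → Polynomial (p ^ (n′ *ℕ m)) 1ᶠ (Tr p m (suc n′))
  Polynomial-Tr {p} 1<p m n′ = subst (λ c → Polynomial N c (Tr p m (suc n′))) (R.+-identityˡ 1ᶠ)
    (Polynomial-+ (lower-terms n′ ℕₚ.≤-refl) (Polynomial-pow N))
    where
    N : ℕ
    N = p ^ (n′ *ℕ m)
    lower-terms : ∀ r → r ≤ n′ → Polynomial N 0ᶠ (Tr p m r)
    lower-terms zero _ = Polynomial-0 N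
    lower-terms (suc r) r<n′ = subst (λ c → Polynomial N c (Tr p m (suc r))) (R.+-identityʳ 0ᶠ)
      (Polynomial-+ (lower-terms r (ℕₚ.<⇒≤ r<n′))
        (Polynomial-raise< (Polynomial-pow _) (ℕₚ.<⇒<′ (ℕₚ.^-monoʳ-< p 1<p (ℕₚ.*-monoˡ-< m r<n′)))))

  factor-theorem : ∀ {D c g} → Polynomial (suc D) c g → ∀ a
                 → ∃ λ k → Polynomial D c k × (∀ x → g x +ᶠ a *ᶠ k x ≡ g a +ᶠ x *ᶠ k x)
  factor-theorem {g = g} (horner {c = c} b h (const h≡c) g≡) a = (λ _ → c) , const (λ _ → refl) , λ x → begin
    g x +ᶠ a *ᶠ c           ≡⟨ cong (λ t → t +ᶠ a *ᶠ c) (trans (g≡ x) (cong (λ t → b +ᶠ x *ᶠ t) (h≡c x))) ⟩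
    (b +ᶠ x *ᶠ c) +ᶠ a *ᶠ c ≡⟨ solve 4 (λ b x a c → (b :+ x :* c) :+ a :* c := (b :+ a :* c) :+ x :* c) refl b x a c ⟩
    (b +ᶠ a *ᶠ c) +ᶠ x *ᶠ c ≡⟨ cong (λ t → t +ᶠ x *ᶠ c) (trans (g≡ a) (cong (λ t → b +ᶠ a *ᶠ t) (h≡c a))) ⟨
    g a +ᶠ x *ᶠ c           ∎
    where open ≡-Reasoning
  factor-theorem {g = g} (horner b h P@(horner _ _ _ _) g≡) a with factor-theorem P a
  ... | k′ , P′ , h-factored = k , horner (h a) k′ P′ (λ _ → refl) , λ x → begin
    g x +ᶠ a *ᶠ k x                                ≡⟨ cong (_+ᶠ a *ᶠ k x) (g≡ x) ⟩
    (b +ᶠ x *ᶠ h x) +ᶠ a *ᶠ (h a +ᶠ x *ᶠ k′ x)     ≡⟨ solve 6 (λ b x hx a ha kx → (b :+ x :* hx) :+ a :* (ha :+ x :* kx)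
                                                             := (b :+ a :* ha) :+ x :* (hx :+ a :* kx)) refl b x (h x) a (h a) (k′ x) ⟩
    (b +ᶠ a *ᶠ h a) +ᶠ x *ᶠ (h x +ᶠ a *ᶠ k′ x)     ≡⟨ cong (λ t → (b +ᶠ a *ᶠ h a) +ᶠ x *ᶠ t) (h-factored x) ⟩
    (b +ᶠ a *ᶠ h a) +ᶠ x *ᶠ (h a +ᶠ x *ᶠ k′ x)     ≡⟨ cong (_+ᶠ x *ᶠ k x) (g≡ a) ⟨
    g a +ᶠ x *ᶠ k x                                ∎
    where
    open ≡-Reasoning
    k : Carrier → Carrier
    k x = h a +ᶠ x *ᶠ k′ x

  root-bound : ∀ {D c g} → Polynomial D c g → (v : Fin (suc D) → Carrier) → Injective _≡_ _≡_ v
             → (∀ i → g (v i) ≡ 0ᶠ) → c ≡ 0ᶠ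
  root-bound (const g≡c) v v-inj roots = trans (sym (g≡c (v Fin.zero))) (roots Fin.zero)
  root-bound {g = g} P@(horner _ _ _ _) v v-inj roots with factor-theorem P (v Fin.zero)
  ... | k , P′ , g-factored = root-bound P′ (v ∘ Fin.suc) (Finₚ.suc-injective ∘ v-inj) k-roots
    where
    k-roots : ∀ i → k (v (Fin.suc i)) ≡ 0ᶠ
    k-roots i = ≢⇒*≡*⇒≡0 (λ v₀≡vᵢ₊₁ → Finₚ.0≢1+n (v-inj v₀≡vᵢ₊₁)) (begin
      v Fin.zero *ᶠ k x           ≡⟨ R.+-identityˡ _ ⟨
      0ᶠ +ᶠ v Fin.zero *ᶠ k x     ≡⟨ cong (_+ᶠ v Fin.zero *ᶠ k x) (roots (Fin.suc i)) ⟨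
      g x +ᶠ v Fin.zero *ᶠ k x    ≡⟨ g-factored x ⟩
      g (v Fin.zero) +ᶠ x *ᶠ k x  ≡⟨ cong (_+ᶠ x *ᶠ k x) (roots Fin.zero) ⟩
      0ᶠ +ᶠ x *ᶠ k x              ≡⟨ R.+-identityˡ _ ⟩
      x *ᶠ k x                    ∎)
      where
      open ≡-Reasoning
      x : Carrier
      x = v (Fin.suc i)

  permutes⇔permutesOn : (π φ f : Carrier → Carrier) (S : Carrier → Set) → Decidable S
    → (∀ x → S (π x)) → (∀ {a} → S a → ∃ λ x → π x ≡ a)
    → (∀ a → S a → S (φ a)) → (∀ x → π (f x) ≡ φ (π x))
    → (∀ x y → π x ≡ π y → f x ≡ f y → x ≡ y)
    → Permutes f ⇔ PermutesOn S φ
  permutes⇔permutesOn π φ f S S? π∈S π-onto φ∈S π∘f≡φ∘π f-fibre-inj = mk⇔ to from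
    where
    to : Permutes f → PermutesOn S φ
    to (_ , f-surj) = φ∈S , φ-inj , φ-surj
      where
      φ-surj : ∀ a → S a → ∃ λ x → S x × φ x ≡ a
      φ-surj a a∈S with π-onto a∈S
      ... | x , πx≡a with f-surj x
      ...   | z , fz≡x = π z , π∈S z , trans (sym (π∘f≡φ∘π z)) (trans (cong π fz≡x) πx≡a)
      -- φ extended by the identity off S, so that finiteness of the whole field applies.
      φ̂ : Carrier → Carrier
      φ̂ a with S? a
      ... | yes _ = φ a
      ... | no _ = a
      φ̂-∈ : ∀ {a} → S a → φ̂ a ≡ φ a
      φ̂-∈ {a} a∈S with S? a
      ... | yes _ = refl
      ... | no a∉S = contradiction a∈S a∉S
      φ̂-∉ : ∀ {a} → ¬ S a → φ̂ a ≡ a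
      φ̂-∉ {a} a∉S with S? a
      ... | yes a∈S = contradiction a∈S a∉S
      ... | no _ = refl
      φ̂-surj : ∀ b → ∃ λ a → φ̂ a ≡ b
      φ̂-surj b with S? b
      ... | no b∉S = b , φ̂-∉ b∉S
      ... | yes b∈S with φ-surj b b∈S
      ...   | a , a∈S , φa≡b = a , trans (φ̂-∈ a∈S) φa≡b
      φ-inj : ∀ a b → S a → S b → φ a ≡ φ b → a ≡ b
      φ-inj a b a∈S b∈S φa≡φb =
        surjective⇒injective φ̂ φ̂-surj a b (trans (φ̂-∈ a∈S) (trans φa≡φb (sym (φ̂-∈ b∈S))))

    from : PermutesOn S φ → Permutes f
    from (_ , φ-inj , _) = f-inj , injective⇒surjective f f-inj
      where
      f-inj : ∀ x y → f x ≡ f y → x ≡ y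
      f-inj x y fx≡fy = f-fibre-inj x y
        (φ-inj (π x) (π y) (π∈S x) (π∈S y) (trans (sym (π∘f≡φ∘π x)) (trans (cong π fx≡fy) (π∘f≡φ∘π y))))
        fx≡fy

  inverse-formula : (π φ φ⁻¹ f₁ h ϕ ϕ̄ Ψ⁻¹ : Carrier → Carrier)
    → (∀ y → ∃ λ x → h (π x) +ᶠ f₁ x ≡ y)
    → (∀ x → π (h (π x) +ᶠ f₁ x) ≡ φ (π x))
    → (∀ x → φ⁻¹ (φ (π x)) ≡ π x)
    → (∀ x → Ψ⁻¹ (ϕ (f₁ x) +ᶠ ϕ̄ (π x)) ≡ x)
    → IsInverse (λ x → h (π x) +ᶠ f₁ x) (λ y → Ψ⁻¹ (ϕ (y -ᶠ h (φ⁻¹ (π y))) +ᶠ ϕ̄ (φ⁻¹ (π y))))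
  inverse-formula π φ φ⁻¹ f₁ h ϕ ϕ̄ Ψ⁻¹ f-surj π∘f≡φ∘π φ⁻¹∘φ≡id Ψ⁻¹∘Ψ≡id = f∘g≡id , g∘f≡id
    where
    f g : Carrier → Carrier
    f x = h (π x) +ᶠ f₁ x
    g y = Ψ⁻¹ (ϕ (y -ᶠ h (φ⁻¹ (π y))) +ᶠ ϕ̄ (φ⁻¹ (π y)))
    g∘f≡id : ∀ x → g (f x) ≡ x
    g∘f≡id x = begin
      Ψ⁻¹ (ϕ (f x -ᶠ h (φ⁻¹ (π (f x)))) +ᶠ ϕ̄ (φ⁻¹ (π (f x))))
        ≡⟨ cong (λ a → Ψ⁻¹ (ϕ (f x -ᶠ h a) +ᶠ ϕ̄ a)) φ⁻¹∘π∘f≡π ⟩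
      Ψ⁻¹ (ϕ (f x -ᶠ h (π x)) +ᶠ ϕ̄ (π x))
        ≡⟨ cong (λ y → Ψ⁻¹ (ϕ y +ᶠ ϕ̄ (π x))) (+-Group.xyx⁻¹≈y (h (π x)) (f₁ x)) ⟩
      Ψ⁻¹ (ϕ (f₁ x) +ᶠ ϕ̄ (π x))
        ≡⟨ Ψ⁻¹∘Ψ≡id x ⟩
      x ∎
      where
      open ≡-Reasoning
      φ⁻¹∘π∘f≡π : φ⁻¹ (π (f x)) ≡ π x
      φ⁻¹∘π∘f≡π = trans (cong φ⁻¹ (π∘f≡φ∘π x)) (φ⁻¹∘φ≡id x)
    f∘g≡id : ∀ y → f (g y) ≡ y
    f∘g≡id y with f-surj y
    ... | x , refl = cong f (g∘f≡id x)

module Trace {p : ℕ} (pr : Prime p) (m n : ℕ) (F : FiniteField (p ^ (n *ℕ m))) where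
  open FiniteField F
  open FF F
  open FiniteFieldProperties F
  open Frobenius pr (characteristic p (n *ℕ m) refl)
  open import Algebra.Solver.Ring.NaturalCoefficients.Default R.commutativeSemiring using (solve; _:=_; _:*_)

  Subfield : Carrier → Set
  Subfield = InSub p m

  Subfield? : Decidable Subfield
  Subfield? a = pow a (p ^ m) ≟ a

  Subfield-* : ∀ {a b} → Subfield a → Subfield b → Subfield (a *ᶠ b)
  Subfield-* {a} {b} a∈ b∈ = trans (pow-distrib-* a b (p ^ m)) (cong₂ _*ᶠ_ a∈ b∈)

  Subfield-pow : ∀ {a} e → Subfield a → Subfield (pow a e)
  Subfield-pow {a} e a∈ = begin
    pow (pow a e) (p ^ m)   ≡⟨ pow-* a e (p ^ m) ⟨
    pow a (e *ℕ p ^ m)      ≡⟨ cong (pow a) (ℕₚ.*-comm e (p ^ m)) ⟩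
    pow a (p ^ m *ℕ e)      ≡⟨ pow-* a (p ^ m) e ⟩
    pow (pow a (p ^ m)) e   ≡⟨ cong (λ b → pow b e) a∈ ⟩
    pow a e                 ∎
    where open ≡-Reasoning

  Subfield-inverse : ∀ {a a⁻¹} → Subfield a → a *ᶠ a⁻¹ ≡ 1ᶠ → Subfield a⁻¹
  Subfield-inverse {a} {a⁻¹} a∈ aa⁻¹≡1 = *-cancelˡ-≢0 a≢0 (begin
    a *ᶠ pow a⁻¹ (p ^ m)                ≡⟨ cong (_*ᶠ pow a⁻¹ (p ^ m)) a∈ ⟨
    pow a (p ^ m) *ᶠ pow a⁻¹ (p ^ m)    ≡⟨ pow-distrib-* a a⁻¹ (p ^ m) ⟨
    pow (a *ᶠ a⁻¹) (p ^ m)              ≡⟨ cong (λ b → pow b (p ^ m)) aa⁻¹≡1 ⟩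
    pow 1ᶠ (p ^ m)                      ≡⟨ pow-1ᶠ (p ^ m) ⟩
    1ᶠ                                  ≡⟨ aa⁻¹≡1 ⟨
    a *ᶠ a⁻¹                            ∎)
    where
    open ≡-Reasoning
    a≢0 : a ≢ 0ᶠ
    a≢0 refl = 0≢1 (trans (sym (R.zeroˡ a⁻¹)) aa⁻¹≡1)

  Subfield-fixed : ∀ {a} → Subfield a → ∀ j → pow a (p ^ (j *ℕ m)) ≡ a
  Subfield-fixed {a} a∈ zero = R.*-identityʳ a
  Subfield-fixed {a} a∈ (suc j) = begin
    pow a (p ^ (m + j *ℕ m))            ≡⟨ cong (pow a) (ℕₚ.^-distribˡ-+-* p m (j *ℕ m)) ⟩
    pow a (p ^ m *ℕ p ^ (j *ℕ m))       ≡⟨ pow-* a (p ^ m) (p ^ (j *ℕ m)) ⟩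
    pow (pow a (p ^ m)) (p ^ (j *ℕ m))  ≡⟨ cong (λ b → pow b (p ^ (j *ℕ m))) a∈ ⟩
    pow a (p ^ (j *ℕ m))                ≡⟨ Subfield-fixed a∈ j ⟩
    a                                   ∎
    where open ≡-Reasoning

  Tr′ : Carrier → Carrier
  Tr′ = Tr p m n

  Tr-+ : ∀ x y → Tr′ (x +ᶠ y) ≡ Tr′ x +ᶠ Tr′ y
  Tr-+ x y = trans (sumℕ-cong n (λ j → frobenius^ (j *ℕ m) x y)) (sumℕ-+ n _ _)

  Tr-0 : Tr′ 0ᶠ ≡ 0ᶠ
  Tr-0 = +-Group.identityʳ-unique (Tr′ 0ᶠ) (Tr′ 0ᶠ) (trans (sym (Tr-+ 0ᶠ 0ᶠ)) (cong Tr′ (R.+-identityʳ 0ᶠ)))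

  Tr-*ˡ : ∀ {c} → Subfield c → ∀ x → Tr′ (c *ᶠ x) ≡ c *ᶠ Tr′ x
  Tr-*ˡ {c} c∈ x = trans (sumℕ-cong n λ j →
      trans (pow-distrib-* c x (p ^ (j *ℕ m))) (cong (_*ᶠ pow x (p ^ (j *ℕ m))) (Subfield-fixed c∈ j)))
    (sumℕ-*ˡ n c _)

  Tr∈Subfield : ∀ x → Subfield (Tr′ x)
  Tr∈Subfield x = trans (frobenius^-sumℕ m n g) (trans (sumℕ-cong n g-step) (sumℕ-rotate n g gₙ≡g₀))
    where
    g : ℕ → Carrier
    g j = pow x (p ^ (j *ℕ m))
    g-step : ∀ j → pow (g j) (p ^ m) ≡ g (suc j)
    g-step j = trans (sym (pow-* x (p ^ (j *ℕ m)) (p ^ m)))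
      (cong (pow x) (trans (ℕₚ.*-comm (p ^ (j *ℕ m)) (p ^ m)) (sym (ℕₚ.^-distribˡ-+-* p m (j *ℕ m)))))
    gₙ≡g₀ : g n ≡ g 0
    gₙ≡g₀ = trans (fermat x) (sym (R.*-identityʳ x))

  Tr-Subfield≡0 : p ∣ n → ∀ {a} → Subfield a → Tr′ a ≡ 0ᶠ
  Tr-Subfield≡0 p∣n {a} a∈ =
    trans (sumℕ-cong n (Subfield-fixed a∈)) (trans (sumℕ-const n a) (∣⇒×≡0 (characteristic p (n *ℕ m) refl) p∣n a))

  ∃Tr≢0 : 0 < n → 0 < m → ∃ λ x → Tr′ x ≢ 0ᶠ
  ∃Tr≢0 0<n 0<m with Finₚ.¬∀⟶∃¬ _ (λ i → Tr′ (enum i) ≡ 0ᶠ) (λ i → Tr′ (enum i) ≟ 0ᶠ) not-all-roots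
    where
    instance
      n≢0 : NonZero n
      n≢0 = ℕ.>-nonZero 0<n
      m≢0 : NonZero m
      m≢0 = ℕ.>-nonZero 0<m
    N : ℕ
    N = p ^ (pred n *ℕ m)
    N<q : N < p ^ (n *ℕ m)
    N<q = ℕₚ.^-monoʳ-< p (prime>1 pr) (ℕₚ.*-monoˡ-< m (ℕₚ.m≤pred[n]⇒suc[m]≤n ℕₚ.≤-refl))
    Tr-Polynomial : Polynomial N 1ᶠ Tr′
    Tr-Polynomial = Polynomial-≗ (Polynomial-Tr (prime>1 pr) m (pred n)) (λ x → cong (λ k → Tr p m k x) (ℕₚ.suc-pred n))
    not-all-roots : ¬ (∀ i → Tr′ (enum i) ≡ 0ᶠ)
    not-all-roots roots = 0≢1 (sym (root-bound Tr-Polynomial (λ i → enum (Fin.inject≤ i N<q))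
      (λ eq → Finₚ.inject≤-injective N<q N<q _ _ (enum-injective _ _ eq)) (λ i → roots (Fin.inject≤ i N<q))))
  ... | i , Tr[eᵢ]≢0 = enum i , Tr[eᵢ]≢0

  Tr-surjective : 0 < n → 0 < m → ∀ {a} → Subfield a → ∃ λ x → Tr′ x ≡ a
  Tr-surjective 0<n 0<m {a} a∈ with ∃Tr≢0 0<n 0<m
  ... | x₀ , Tr[x₀]≢0 with inverse (Tr′ x₀) Tr[x₀]≢0
  ...   | t⁻¹ , tt⁻¹≡1 = (a *ᶠ t⁻¹) *ᶠ x₀ , (begin
    Tr′ ((a *ᶠ t⁻¹) *ᶠ x₀)     ≡⟨ Tr-*ˡ (Subfield-* a∈ (Subfield-inverse (Tr∈Subfield x₀) tt⁻¹≡1)) x₀ ⟩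
    (a *ᶠ t⁻¹) *ᶠ Tr′ x₀       ≡⟨ solve 3 (λ a t⁻¹ t → (a :* t⁻¹) :* t := a :* (t :* t⁻¹)) refl a t⁻¹ (Tr′ x₀) ⟩
    a *ᶠ (Tr′ x₀ *ᶠ t⁻¹)       ≡⟨ cong (a *ᶠ_) tt⁻¹≡1 ⟩
    a *ᶠ 1ᶠ                    ≡⟨ R.*-identityʳ a ⟩
    a                          ∎)
    where open ≡-Reasoning

  Tr-sumFin≡0 : ∀ k (g : Fin k → Carrier) → (∀ i → Tr′ (g i) ≡ 0ᶠ) → Tr′ (sumFin k g) ≡ 0ᶠ
  Tr-sumFin≡0 zero g _ = Tr-0
  Tr-sumFin≡0 (suc k) g Tr-g≡0 = begin
    Tr′ (g Fin.zero +ᶠ sumFin k (g ∘ Fin.suc))        ≡⟨ Tr-+ _ _ ⟩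
    Tr′ (g Fin.zero) +ᶠ Tr′ (sumFin k (g ∘ Fin.suc))  ≡⟨ cong₂ _+ᶠ_ (Tr-g≡0 Fin.zero) (Tr-sumFin≡0 k _ (Tr-g≡0 ∘ Fin.suc)) ⟩
    0ᶠ +ᶠ 0ᶠ                                          ≡⟨ R.+-identityʳ 0ᶠ ⟩
    0ᶠ                                                ∎
    where open ≡-Reasoning

  module _ {d : ℕ} .{{_ : NonZero d}} (d∣p^m∸1 : d ∣ p ^ m ∸ 1) where
    t : ℕ
    t = (p ^ (n *ℕ m) ∸ 1) / d

    t*d≡q∸1 : t *ℕ d ≡ p ^ (n *ℕ m) ∸ 1
    t*d≡q∸1 = m/n*n≡m (∣-trans d∣p^m∸1 (subst (λ e → p ^ m ∸ 1 ∣ e ∸ 1) [p^m]^n≡q (pred∣pred^ (p ^ m) n)))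
      where
      [p^m]^n≡q : (p ^ m) ^ n ≡ p ^ (n *ℕ m)
      [p^m]^n≡q = trans (ℕₚ.^-*-assoc p m n) (cong (p ^_) (ℕₚ.*-comm m n))

    pow-t∈Subfield : ∀ {z} → z ≢ 0ᶠ → Subfield (pow z t)
    pow-t∈Subfield {z} z≢0 = begin
      pow (pow z t) (p ^ m)                ≡⟨ cong (pow (pow z t)) p^m≡1+d*r ⟩
      pow z t *ᶠ pow (pow z t) (d *ℕ r)    ≡⟨ cong (pow z t *ᶠ_) (pow-* (pow z t) d r) ⟩
      pow z t *ᶠ pow (pow (pow z t) d) r   ≡⟨ cong (λ w → pow z t *ᶠ pow w r) [zᵗ]ᵈ≡1 ⟩
      pow z t *ᶠ pow 1ᶠ r                  ≡⟨ cong (pow z t *ᶠ_) (pow-1ᶠ r) ⟩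
      pow z t *ᶠ 1ᶠ                        ≡⟨ R.*-identityʳ _ ⟩
      pow z t                              ∎
      where
      open ≡-Reasoning
      open _∣_ d∣p^m∸1 renaming (quotient to r; equality to p^m∸1≡r*d)
      [zᵗ]ᵈ≡1 : pow (pow z t) d ≡ 1ᶠ
      [zᵗ]ᵈ≡1 = trans (sym (pow-* z t d)) (trans (cong (pow z) t*d≡q∸1) (fermat-pred z≢0))
      p^m≡1+d*r : p ^ m ≡ suc (d *ℕ r)
      p^m≡1+d*r = trans (sym (ℕₚ.m∸n+n≡m (ℕₚ.m^n>0 p m)))
        (trans (ℕₚ.+-comm _ 1) (cong suc (trans p^m∸1≡r*d (ℕₚ.*-comm r d))))

    Tr-term : ∀ {z} → Tr′ z ≡ 0ᶠ → ∀ {c} → Subfield c → ∀ s → Tr′ (c *ᶠ pow z (1 + s *ℕ t)) ≡ 0ᶠ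
    Tr-term {z} Trz≡0 {c} c∈ s with z ≟ 0ᶠ
    ... | yes refl = trans (cong Tr′ (trans (cong (c *ᶠ_) (R.zeroˡ _)) (R.zeroʳ c))) Tr-0
    ... | no z≢0 = begin
      Tr′ (c *ᶠ (z *ᶠ pow z (s *ℕ t)))  ≡⟨ cong (λ w → Tr′ (c *ᶠ (z *ᶠ w))) (trans (cong (pow z) (ℕₚ.*-comm s t)) (pow-* z t s)) ⟩
      Tr′ (c *ᶠ (z *ᶠ E))               ≡⟨ cong Tr′ (solve 3 (λ c z E → c :* (z :* E) := (c :* E) :* z) refl c z E) ⟩
      Tr′ ((c *ᶠ E) *ᶠ z)               ≡⟨ Tr-*ˡ (Subfield-* c∈ (Subfield-pow s (pow-t∈Subfield z≢0))) z ⟩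
      (c *ᶠ E) *ᶠ Tr′ z                 ≡⟨ cong ((c *ᶠ E) *ᶠ_) Trz≡0 ⟩
      (c *ᶠ E) *ᶠ 0ᶠ                    ≡⟨ R.zeroʳ _ ⟩
      0ᶠ                                ∎
      where
      open ≡-Reasoning
      E : Carrier
      E = pow (pow z t) s

    Tr-hfun : p ∣ n → ∀ {δ} → Tr′ δ ≡ 0ᶠ → ∀ {a} → Subfield a
            → ∀ k (b : Fin k → Carrier) → (∀ i → Subfield (b i)) → (s : Fin k → ℕ)
            → Tr′ (hfun p n m d δ k b s a) ≡ 0ᶠ
    Tr-hfun p∣n {δ} Trδ≡0 {a} a∈ k b b∈ s = Tr-sumFin≡0 k _ (λ i → Tr-term Tr[a+δ]≡0 (b∈ i) (s i))
      where
      Tr[a+δ]≡0 : Tr′ (a +ᶠ δ) ≡ 0ᶠ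
      Tr[a+δ]≡0 = trans (Tr-+ a δ) (trans (cong₂ _+ᶠ_ (Tr-Subfield≡0 p∣n a∈) Trδ≡0) (R.+-identityʳ 0ᶠ))

theorem2 : (p d n m : ℕ) → Prime p → .{{_ : NonZero d}} → 0 < n → 0 < m
    → d ∣ (p ^ m ∸ 1) → p ∣ n
    → (F : FiniteField (p ^ (n *ℕ m)))
    → let open FiniteField F
          open FF F
      in (δ : Carrier) → Tr p m n δ ≡ 0ᶠ
      → (f1 φ : Carrier → Carrier)
      → (∀ a → InSub p m a → InSub p m (φ a))
      → (∀ x → Tr p m n (f1 x) ≡ φ (Tr p m n x))
      → (∀ a → InSub p m a → ∀ x y → Tr p m n x ≡ a → Tr p m n y ≡ a → f1 x ≡ f1 y → x ≡ y)
      → (k : ℕ) → 0 < k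
      → (b : Fin k → Carrier) → (∀ i → InSub p m (b i))
      → (s : Fin k → ℕ) → (∀ i → 0 < s i)
      → (Permutes (ffun p n m d δ k b s f1) ⇔ PermutesOn (InSub p m) φ)
        × (Permutes (ffun p n m d δ k b s f1)
           → (ϕ ϕ̄ : Carrier → Carrier)
           → Permutes (λ x → ϕ (f1 x) +ᶠ ϕ̄ (Tr p m n x))
           → (φinv Ψinv : Carrier → Carrier)
           → IsInverseOn (InSub p m) φ φinv
           → IsInverse (λ x → ϕ (f1 x) +ᶠ ϕ̄ (Tr p m n x)) Ψinv
           → IsInverse (ffun p n m d δ k b s f1)
               (λ x → Ψinv (ϕ (x -ᶠ hfun p n m d δ k b s (φinv (Tr p m n x)))
                            +ᶠ ϕ̄ (φinv (Tr p m n x)))))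
theorem2 p d n m pr 0<n 0<m d∣p^m∸1 p∣n F δ Trδ≡0 f1 φ φ∈S Tr∘f1≡φ∘Tr f1-fibre-inj k _ b b∈S s _ =
  permutes⇔permutesOn Tr′ φ f Subfield Subfield? Tr∈Subfield (Tr-surjective 0<n 0<m) φ∈S Tr∘f≡φ∘Tr f-fibre-inj ,
  λ (_ , f-surj) ϕ ϕ̄ _ φinv Ψinv (_ , _ , φinv∘φ≡id) (_ , Ψinv∘Ψ≡id) →
    inverse-formula Tr′ φ φinv f1 h ϕ ϕ̄ Ψinv f-surj Tr∘f≡φ∘Tr
      (λ x → φinv∘φ≡id (Tr′ x) (Tr∈Subfield x)) Ψinv∘Ψ≡id
  where
  open FiniteField F
  open FF F
  open FiniteFieldProperties F
  open Trace pr m n F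
  h f : Carrier → Carrier
  h = hfun p n m d δ k b s
  f = ffun p n m d δ k b s f1
  Tr∘f≡φ∘Tr : ∀ x → Tr′ (f x) ≡ φ (Tr′ x)
  Tr∘f≡φ∘Tr x = begin
    Tr′ (h (Tr′ x) +ᶠ f1 x)        ≡⟨ Tr-+ (h (Tr′ x)) (f1 x) ⟩
    Tr′ (h (Tr′ x)) +ᶠ Tr′ (f1 x)  ≡⟨ cong₂ _+ᶠ_ Tr[h[Trx]]≡0 (Tr∘f1≡φ∘Tr x) ⟩
    0ᶠ +ᶠ φ (Tr′ x)                ≡⟨ R.+-identityˡ _ ⟩
    φ (Tr′ x)                      ∎
    where
    open ≡-Reasoning
    Tr[h[Trx]]≡0 : Tr′ (h (Tr′ x)) ≡ 0ᶠ
    Tr[h[Trx]]≡0 = Tr-hfun d∣p^m∸1 p∣n Trδ≡0 (Tr∈Subfield x) k b b∈S s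
  f-fibre-inj : ∀ x y → Tr′ x ≡ Tr′ y → f x ≡ f y → x ≡ y
  f-fibre-inj x y Trx≡Try fx≡fy = f1-fibre-inj (Tr′ x) (Tr∈Subfield x) x y refl (sym Trx≡Try)
    (+-Group.∙-cancelˡ (h (Tr′ x)) (f1 x) (f1 y) (trans fx≡fy (cong (λ a → h a +ᶠ f1 y) (sym Trx≡Try))))
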